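{- Let $S=\{i_1<i_2<\cdots<i_s\}$ be a nonempty admissible set, and let $S_1=S\setminus\{i_s\}$ and $S_2=S_1\cup\{i_s-1\}$. Then \[\#\widehat{P}(S,n)=\binom{n}{i_s-1}\,\#\widehat{P}(S_1,i_s-1)\,2^{n-i_s}-\#\widehat{P}(S_1,n)-\#\widehat{P}(S_2,n).\]
   Context: $S_n$ is the set of permutations $\pi=\pi_1\cdots\pi_n$ of $\{1,\dots,n\}$ ($S_0$ consisting of the empty word). Set $\pi_0=0$. An index $i\in\{1,\dots,n-1\}$ is a peak of $\pi$ if $\pi_{i-1}<\pi_i>\pi_{i+1}$. $\widehat{P}(S,n)$ is the set of $\pi\in S_n$ whose peak set (in this sense, with $\pi_0=0$) equals $S$. $S$ is $n$-admissible if $\widehat{P}(S,n)\ne\emptyset$, and admissible if $n$-admissible for some $n$; the identity is asserted for every $n$ for which $S$ is $n$-admissible. -}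

module Defs where

open import Data.Bool using (Bool; true; false; _∧_; _∨_; if_then_else_)
open import Data.Nat using (ℕ; zero; suc; _<ᵇ_; _≡ᵇ_)
open import Data.List using (List; []; _∷_; [_]; _++_; map; concatMap; length; filterᵇ)
open import Data.Bool.ListAction using (all; any)

insertAll : {A : Set} → A → List A → List (List A)
insertAll x [] = [ x ∷ [] ]
insertAll x (y ∷ ys) = (x ∷ y ∷ ys) ∷ map (y ∷_) (insertAll x ys)

perms : ℕ → List (List ℕ)
perms zero = [ [] ]
perms (suc n) = concatMap (insertAll (suc n)) (perms n)

-- peaksFrom i (a ∷ b ∷ c ∷ …): b sits at index i; it is a peak iff a < b > c.
peaksFrom : ℕ → List ℕ → List ℕ
peaksFrom i (a ∷ b ∷ c ∷ rest) =
  (if (a <ᵇ b) ∧ (c <ᵇ b) then [ i ] else []) ++ peaksFrom (suc i) (b ∷ c ∷ rest)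
peaksFrom i _ = []

-- Peak set of π, with the convention π₀ = 0: indices i ∈ {1,…,n-1}
-- with π_{i-1} < π_i > π_{i+1}.
peakSet : List ℕ → List ℕ
peakSet π = peaksFrom 1 (0 ∷ π)

elemᵇ : ℕ → List ℕ → Bool
elemᵇ x ys = any (λ y → x ≡ᵇ y) ys

sameSetᵇ : List ℕ → List ℕ → Bool
sameSetᵇ A B = all (λ a → elemᵇ a B) A ∧ all (λ b → elemᵇ b A) B

Phat : List ℕ → ℕ → List (List ℕ)
Phat S n = filterᵇ (λ π → sameSetᵇ (peakSet π) S) (perms n)

#Phat : List ℕ → ℕ → ℕ
#Phat S n = length (Phat S n)

module Submission where

-- Theorem 4.1:  for S = S₁ ∪ {iₛ} admissible with iₛ > max S₁ and S₂ = S₁ ∪ {iₛ-1},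
--   #P̂(S,n) + #P̂(S₁,n) + #P̂(S₂,n) = C(n,iₛ-1) · #P̂(S₁,iₛ-1) · 2^(n-iₛ)
-- (the paper's identity with its subtractions moved to the left).
--
-- Whether π has a given peak set depends only on its up-down word, the
-- sequence of comparisons π_{i-1} ? π_i (with π₀ = 0).  Write iₛ = k+1.  Two
-- peaks are never adjacent, so a word has peak set S, S₁ or S₂ (exclusively)
-- iff its first k letters have peak set S₁ and it has no peak beyond k+1; the
-- three sets are the three possible patterns at the positions k, k+1.  Hence
-- the left-hand side counts the π whose prefix π₁…π_k has peak set S₁ and whose
-- suffix π_{k+1}…π_n has no interior peak.  Choosing the values of the prefix
-- (C(n,k) ways), its pattern (#P̂(S₁,k) ways) and a peak-free "valley" suffix
-- (2^(n-k-1) ways) gives the right-hand side.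

open import Defs
open import Data.Nat using (ℕ; zero; suc; _+_; _*_; _∸_; _^_; _<_; _≤_; z≤n; s≤s; s≤s⁻¹; z<s; _<ᵇ_; _≡ᵇ_)
open import Data.Nat.Properties
open import Data.Nat.Combinatorics using (_C_; nCn≡1; nCk+nC[k+1]≡[n+1]C[k+1])
open import Data.Nat.Tactic.RingSolver using (solve-∀)
open import Data.Bool using (Bool; true; false; _∧_; _∨_; not; if_then_else_; T)
open import Data.Bool.Properties using (∨-identityʳ; ∨-zeroʳ; ∧-identityʳ; ∧-zeroʳ; not-injective)
open import Data.Bool.ListAction using (all)
open import Data.Empty using (⊥-elim)
open import Data.Product using (_×_; _,_; proj₁; proj₂; ∃-syntax)
open import Data.Product.Function.NonDependent.Propositional using (_×-⇔_)
open import Data.Sum using (inj₁; inj₂)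
open import Data.List using (List; []; _∷_; [_]; _++_; map; concatMap; length; filterᵇ; take; drop)
open import Data.List.Properties using (map-∘; take-all; drop-all; drop-drop)
open import Data.List.Relation.Unary.Linked using (Linked; _∷_)
open import Data.List.Relation.Unary.All as All using (All; []; _∷_)
open import Data.List.Relation.Unary.All.Properties using (map⁺; concat⁺)
open import Function using (_∘_)
open import Function.Bundles using (_⇔_; mk⇔; Equivalence)
import Function.Properties.Equivalence as ⇔
open import Relation.Nullary using (yes; no)
open import Relation.Binary.PropositionalEquality using (_≡_; _≢_; refl; sym; trans; cong; cong₂; subst; module ≡-Reasoning)
open ≡-Reasoning

private
  variable
    A : Set

𝟙 : Bool → ℕ
𝟙 true = 1
𝟙 false = 0

𝟙-∧ : ∀ a b → 𝟙 (a ∧ b) ≡ 𝟙 a * 𝟙 b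
𝟙-∧ true b = sym (+-identityʳ (𝟙 b))
𝟙-∧ false b = refl

_==_ : Bool → Bool → Bool
true == b = b
false == b = not b

==-true : ∀ {a b} → (a == b) ≡ true ⇔ a ≡ b
==-true {true} {true} = mk⇔ (λ _ → refl) (λ _ → refl)
==-true {true} {false} = mk⇔ (λ ()) (λ ())
==-true {false} {true} = mk⇔ (λ ()) (λ ())
==-true {false} {false} = mk⇔ (λ _ → refl) (λ _ → refl)

∧-true : ∀ {a b} → (a ∧ b) ≡ true ⇔ (a ≡ true × b ≡ true)
∧-true {true} = mk⇔ (λ e → refl , e) proj₂
∧-true {false} = mk⇔ (λ ()) (λ { (() , _) })

bool-⇔ : ∀ {a b} → a ≡ true ⇔ b ≡ true → a ≡ b
bool-⇔ {true} e = sym (Equivalence.to e refl)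
bool-⇔ {false} {true} e = Equivalence.from e refl
bool-⇔ {false} {false} e = refl

false≢true : false ≢ true
false≢true ()

≡ᵇ-true : ∀ {m n} → (m ≡ᵇ n) ≡ true → m ≡ n
≡ᵇ-true {m} {n} e = ≡ᵇ⇒≡ m n (subst T (sym e) _)

≡ᵇ-refl : ∀ n → (n ≡ᵇ n) ≡ true
≡ᵇ-refl zero = refl
≡ᵇ-refl (suc n) = ≡ᵇ-refl n

≡ᵇ-false : ∀ {m n} → m ≢ n → (m ≡ᵇ n) ≡ false
≡ᵇ-false {m} {n} m≢n with m ≡ᵇ n in e
... | false = refl
... | true = ⊥-elim (m≢n (≡ᵇ-true e))

elemᵇ-++ : ∀ j (X Y : List ℕ) → elemᵇ j (X ++ Y) ≡ (elemᵇ j X ∨ elemᵇ j Y)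
elemᵇ-++ j [] Y = refl
elemᵇ-++ j (x ∷ X) Y with j ≡ᵇ x
... | true = refl
... | false = elemᵇ-++ j X Y

elemᵇ-snoc : ∀ j (X : List ℕ) m → elemᵇ j (X ++ [ m ]) ≡ (elemᵇ j X ∨ (j ≡ᵇ m))
elemᵇ-snoc j X m = trans (elemᵇ-++ j X [ m ]) (cong (elemᵇ j X ∨_) (∨-identityʳ (j ≡ᵇ m)))

elemᵇ-last : ∀ (X : List ℕ) m → elemᵇ m (X ++ [ m ]) ≡ true
elemᵇ-last X m = trans (elemᵇ-snoc m X m) (trans (cong (elemᵇ m X ∨_) (≡ᵇ-refl m)) (∨-zeroʳ _))

elemᵇ-self : ∀ (X : List ℕ) → All (λ x → elemᵇ x X ≡ true) X
elemᵇ-self [] = []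
elemᵇ-self (y ∷ X) = cong (_∨ elemᵇ y X) (≡ᵇ-refl y)
  ∷ All.map (λ {x} e → trans (cong ((x ≡ᵇ y) ∨_) e) (∨-zeroʳ _)) (elemᵇ-self X)

elemᵇ-above : ∀ {k j} {X : List ℕ} → All (_< k) X → k ≤ j → elemᵇ j X ≡ false
elemᵇ-above [] _ = refl
elemᵇ-above {k} {j} {x ∷ _} (x<k ∷ X<k) k≤j =
  cong₂ _∨_ (≡ᵇ-false {j} {x} (λ { refl → <⇒≱ x<k k≤j })) (elemᵇ-above X<k k≤j)

all-elim : ∀ (p : ℕ → Bool) X → all p X ≡ true → ∀ a → elemᵇ a X ≡ true → p a ≡ true
all-elim p (y ∷ X) h a a∈ with a ≡ᵇ y in e
... | true = subst (λ z → p z ≡ true) (sym (≡ᵇ-true e)) (proj₁ (Equivalence.to (∧-true {p y}) h))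
... | false = all-elim p X (proj₂ (Equivalence.to (∧-true {p y}) h)) a a∈

all-intro : ∀ (p : ℕ → Bool) X → (∀ a → elemᵇ a X ≡ true → p a ≡ true) → all p X ≡ true
all-intro p [] h = refl
all-intro p (y ∷ X) h = Equivalence.from ∧-true
  ( h y (cong (_∨ elemᵇ y X) (≡ᵇ-refl y))
  , all-intro p X (λ a e → h a (trans (cong ((a ≡ᵇ y) ∨_) e) (∨-zeroʳ _))))

sameSetᵇ-true : ∀ X Y → sameSetᵇ X Y ≡ true ⇔ (∀ j → elemᵇ j X ≡ elemᵇ j Y)
sameSetᵇ-true X Y = mk⇔ to from
  where
    to : sameSetᵇ X Y ≡ true → ∀ j → elemᵇ j X ≡ elemᵇ j Y
    to h j with Equivalence.to ∧-true h
    ... | X⊆Y , Y⊆X = bool-⇔ (mk⇔ (all-elim _ X X⊆Y j) (all-elim _ Y Y⊆X j))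
    from : (∀ j → elemᵇ j X ≡ elemᵇ j Y) → sameSetᵇ X Y ≡ true
    from eq = Equivalence.from ∧-true
      ( all-intro _ X (λ a e → trans (sym (eq a)) e)
      , all-intro _ Y (λ a e → trans (eq a) e))

sumOver : (A → ℕ) → List A → ℕ
sumOver f [] = 0
sumOver f (x ∷ xs) = f x + sumOver f xs

sumOver-++ : ∀ (f : A → ℕ) xs ys → sumOver f (xs ++ ys) ≡ sumOver f xs + sumOver f ys
sumOver-++ f [] ys = refl
sumOver-++ f (x ∷ xs) ys = trans (cong (f x +_) (sumOver-++ f xs ys)) (sym (+-assoc (f x) _ _))

sumOver-concatMap : ∀ {B : Set} (f : B → ℕ) (F : A → List B) xs →
  sumOver f (concatMap F xs) ≡ sumOver (sumOver f ∘ F) xs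
sumOver-concatMap f F [] = refl
sumOver-concatMap f F (x ∷ xs) =
  trans (sumOver-++ f (F x) (concatMap F xs)) (cong (sumOver f (F x) +_) (sumOver-concatMap f F xs))

sumOver-map : ∀ {B : Set} (f : B → ℕ) (g : A → B) xs → sumOver f (map g xs) ≡ sumOver (f ∘ g) xs
sumOver-map f g [] = refl
sumOver-map f g (x ∷ xs) = cong (f (g x) +_) (sumOver-map f g xs)

sumOver-cong : ∀ {f g : A → ℕ} xs → (∀ x → f x ≡ g x) → sumOver f xs ≡ sumOver g xs
sumOver-cong [] _ = refl
sumOver-cong (x ∷ xs) f≗g = cong₂ _+_ (f≗g x) (sumOver-cong xs f≗g)

sumOver-congᴬ : ∀ {P : A → Set} {f g : A → ℕ} {xs} → All P xs →
  (∀ x → P x → f x ≡ g x) → sumOver f xs ≡ sumOver g xs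
sumOver-congᴬ [] _ = refl
sumOver-congᴬ {xs = x ∷ _} (px ∷ pxs) f≗g = cong₂ _+_ (f≗g x px) (sumOver-congᴬ pxs f≗g)

sumOver-+ : ∀ (f g : A → ℕ) xs → sumOver (λ x → f x + g x) xs ≡ sumOver f xs + sumOver g xs
sumOver-+ f g [] = refl
sumOver-+ f g (x ∷ xs) =
  trans (cong (f x + g x +_) (sumOver-+ f g xs)) (interchange (f x) (g x) (sumOver f xs) (sumOver g xs))
  where
    interchange : ∀ a b c d → a + b + (c + d) ≡ a + c + (b + d)
    interchange = solve-∀

sumOver-* : ∀ c (f : A → ℕ) xs → sumOver (λ x → c * f x) xs ≡ c * sumOver f xs
sumOver-* c f [] = sym (*-zeroʳ c)
sumOver-* c f (x ∷ xs) =
  trans (cong (c * f x +_) (sumOver-* c f xs)) (sym (*-distribˡ-+ c (f x) (sumOver f xs)))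

data Step : Set where
  rise fall level : Step

step : ℕ → ℕ → Step
step zero zero = level
step zero (suc _) = rise
step (suc _) zero = fall
step (suc a) (suc b) = step a b

isRise : Step → Bool
isRise rise = true
isRise _ = false

isFall : Step → Bool
isFall fall = true
isFall _ = false

isRise-step : ∀ a b → isRise (step a b) ≡ (a <ᵇ b)
isRise-step zero zero = refl
isRise-step zero (suc b) = refl
isRise-step (suc a) zero = refl
isRise-step (suc a) (suc b) = isRise-step a b

isFall-step : ∀ a b → isFall (step a b) ≡ (b <ᵇ a)
isFall-step zero zero = refl
isFall-step zero (suc b) = refl
isFall-step (suc a) zero = refl
isFall-step (suc a) (suc b) = isFall-step a b

step-rise : ∀ {a b} → a < b → step a b ≡ rise
step-rise {zero} {suc b} _ = refl
step-rise {suc a} {suc b} (s≤s a<b) = step-rise a<b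

step-fall : ∀ {a b} → b < a → step a b ≡ fall
step-fall {suc a} {zero} _ = refl
step-fall {suc a} {suc b} (s≤s b<a) = step-fall b<a

updown : ℕ → List ℕ → List Step
updown a [] = []
updown a (x ∷ xs) = step a x ∷ updown x xs

updown-length : ∀ a π → length (updown a π) ≡ length π
updown-length a [] = refl
updown-length a (x ∷ xs) = cong suc (updown-length x xs)

-- Words obtained by inserting a new maximum at every position: a rise and a
-- fall replace the letter at the insertion point (a final rise at the end).
insertMax : List Step → List (List Step)
insertMax [] = (rise ∷ []) ∷ []
insertMax (s ∷ w) = (rise ∷ fall ∷ w) ∷ map (s ∷_) (insertMax w)

updown-insertAll : ∀ {N} a π → a < N → All (_< N) π →
  map (updown a) (insertAll N π) ≡ insertMax (updown a π)
updown-insertAll a [] a<N [] rewrite step-rise a<N = refl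
updown-insertAll {N} a (y ∷ ys) a<N (y<N ∷ ys<N) rewrite step-rise a<N | step-fall y<N =
  cong ((rise ∷ fall ∷ updown y ys) ∷_) (begin
    map (updown a) (map (y ∷_) (insertAll N ys))        ≡⟨ sym (map-∘ (insertAll N ys)) ⟩
    map (λ π → step a y ∷ updown y π) (insertAll N ys)  ≡⟨ map-∘ (insertAll N ys) ⟩
    map (step a y ∷_) (map (updown y) (insertAll N ys)) ≡⟨ cong (map (step a y ∷_)) (updown-insertAll y ys y<N ys<N) ⟩
    map (step a y ∷_) (insertMax (updown y ys))         ∎)

Sized : ℕ → List ℕ → Set
Sized n π = length π ≡ n × All (_≤ n) π

insertAll-length : ∀ (x : ℕ) ys → All (λ zs → length zs ≡ suc (length ys)) (insertAll x ys)
insertAll-length x [] = refl ∷ []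
insertAll-length x (y ∷ ys) = refl ∷ map⁺ (All.map (cong suc) (insertAll-length x ys))

insertAll-entries : ∀ {P : ℕ → Set} {x} ys → P x → All P ys → All (All P) (insertAll x ys)
insertAll-entries [] px [] = (px ∷ []) ∷ []
insertAll-entries (y ∷ ys) px (py ∷ pys) = (px ∷ py ∷ pys) ∷ map⁺ (All.map (py ∷_) (insertAll-entries ys px pys))

perms-sized : ∀ n → All (Sized n) (perms n)
perms-sized zero = (refl , []) ∷ []
perms-sized (suc n) = concat⁺ (map⁺ (All.map grow (perms-sized n)))
  where
    grow : ∀ {π} → Sized n π → All (Sized (suc n)) (insertAll (suc n) π)
    grow {π} (len , bounded) =
      All.map (λ { (l , b) → trans l (cong suc len) , b })
        (All.zip (insertAll-length (suc n) π , insertAll-entries π ≤-refl (All.map m≤n⇒m≤1+n bounded)))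

total : ℕ → (List Step → ℕ) → ℕ
total n f = sumOver (f ∘ updown 0) (perms n)

onInsertions : (List Step → ℕ) → List Step → ℕ
onInsertions f w = sumOver f (insertMax w)

total-zero : ∀ f → total 0 f ≡ f []
total-zero f = +-identityʳ (f [])

-- S_{n+1} is S_n with the maximum inserted everywhere.
total-suc : ∀ n f → total (suc n) f ≡ total n (onInsertions f)
total-suc n f =
  trans (sumOver-concatMap (f ∘ updown 0) (insertAll (suc n)) (perms n))
        (sumOver-congᴬ (perms-sized n) insertions)
  where
    insertions : ∀ π → Sized n π → sumOver (f ∘ updown 0) (insertAll (suc n) π) ≡ onInsertions f (updown 0 π)
    insertions π (_ , bounded) =
      trans (sym (sumOver-map f (updown 0) (insertAll (suc n) π)))
            (cong (sumOver f) (updown-insertAll 0 π z<s (All.map s≤s bounded)))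

total-cong : ∀ n {f g : List Step → ℕ} → (∀ w → length w ≡ n → f w ≡ g w) → total n f ≡ total n g
total-cong n f≗g = sumOver-congᴬ (perms-sized n)
  (λ π (len , _) → f≗g (updown 0 π) (trans (updown-length 0 π) len))

total-+ : ∀ n f g → total n (λ w → f w + g w) ≡ total n f + total n g
total-+ n f g = sumOver-+ (f ∘ updown 0) (g ∘ updown 0) (perms n)

total-* : ∀ n c f → total n (λ w → c * f w) ≡ c * total n f
total-* n c f = sumOver-* c (f ∘ updown 0) (perms n)

-- g ignores the first letter (the comparison with the entry before the suffix).
HeadBlind : (List Step → ℕ) → Set
HeadBlind g = ∀ s s' u → g (s ∷ u) ≡ g (s' ∷ u)

onInsertions-cons : ∀ f s u → onInsertions f (s ∷ u) ≡ f (rise ∷ fall ∷ u) + onInsertions (f ∘ (s ∷_)) u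
onInsertions-cons f s u = cong (f (rise ∷ fall ∷ u) +_) (sumOver-map f (s ∷_) (insertMax u))

onInsertions-headBlind : ∀ g → HeadBlind g → HeadBlind (onInsertions g)
onInsertions-headBlind g blind s s' u = begin
  onInsertions g (s ∷ u)                              ≡⟨ onInsertions-cons g s u ⟩
  g (rise ∷ fall ∷ u) + onInsertions (g ∘ (s ∷_)) u   ≡⟨ cong (g (rise ∷ fall ∷ u) +_) (sumOver-cong (insertMax u) (blind s s')) ⟩
  g (rise ∷ fall ∷ u) + onInsertions (g ∘ (s' ∷_)) u  ≡⟨ sym (onInsertions-cons g s' u) ⟩
  onInsertions g (s' ∷ u)                             ∎

-- Inserting the maximum into a word of length > k either happens among its
-- first k letters, which then form an insertion into the prefix of length k,
-- or later, leaving the prefix of length k+1 intact.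
onInsertions-split : ∀ k (f g : List Step → ℕ) → HeadBlind g → ∀ w → suc k ≤ length w →
  onInsertions (λ u → f (take (suc k) u) * g (drop (suc k) u)) w
    ≡ onInsertions f (take k w) * g (drop k w) + f (take (suc k) w) * onInsertions g (drop (suc k) w)
onInsertions-split zero f g blind (s ∷ w) _ = begin
  f (rise ∷ []) * g (fall ∷ w) + sumOver (λ u → f (take 1 u) * g (drop 1 u)) (map (s ∷_) (insertMax w))
    ≡⟨ cong₂ _+_ (cong (f (rise ∷ []) *_) (blind fall s w)) (sumOver-map _ (s ∷_) (insertMax w)) ⟩
  f (rise ∷ []) * g (s ∷ w) + sumOver (λ u → f (s ∷ []) * g u) (insertMax w)
    ≡⟨ cong₂ _+_ (cong (_* g (s ∷ w)) (sym (+-identityʳ (f (rise ∷ []))))) (sumOver-* (f (s ∷ [])) g (insertMax w)) ⟩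
  (f (rise ∷ []) + 0) * g (s ∷ w) + f (s ∷ []) * onInsertions g w
    ∎
onInsertions-split (suc k) f g blind (s ∷ w) (s≤s k<w) = begin
  f (rise ∷ fall ∷ take k w) * g (drop k w)
    + sumOver (λ u → f (take (2 + k) u) * g (drop (2 + k) u)) (map (s ∷_) (insertMax w))
    ≡⟨ cong (f (rise ∷ fall ∷ take k w) * g (drop k w) +_)
         (trans (sumOver-map _ (s ∷_) (insertMax w)) (onInsertions-split k f′ g blind w k<w)) ⟩
  f (rise ∷ fall ∷ take k w) * g (drop k w)
    + (onInsertions f′ (take k w) * g (drop k w) + f′ (take (suc k) w) * onInsertions g (drop (suc k) w))
    ≡⟨ regroup (f (rise ∷ fall ∷ take k w)) (onInsertions f′ (take k w)) (g (drop k w)) _ ⟩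
  (f (rise ∷ fall ∷ take k w) + onInsertions f′ (take k w)) * g (drop k w)
    + f′ (take (suc k) w) * onInsertions g (drop (suc k) w)
    ≡⟨ cong (λ a → a * g (drop k w) + f′ (take (suc k) w) * onInsertions g (drop (suc k) w))
         (sym (onInsertions-cons f s (take k w))) ⟩
  onInsertions f (s ∷ take k w) * g (drop k w) + f′ (take (suc k) w) * onInsertions g (drop (suc k) w)
    ∎
  where
    f′ : List Step → ℕ
    f′ = f ∘ (s ∷_)
    regroup : ∀ a p x q → a * x + (p * x + q) ≡ (a + p) * x + q
    regroup = solve-∀

total-split-whole : ∀ n (f g : List Step → ℕ) →
  total n (λ w → f (take n w) * g (drop n w)) ≡ (n C n) * total n f * total (n ∸ n) g
total-split-whole n f g = begin
  total n (λ w → f (take n w) * g (drop n w)) ≡⟨ total-cong n whole ⟩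
  total n (λ w → g [] * f w)                  ≡⟨ total-* n (g []) f ⟩
  g [] * total n f                            ≡⟨ *-comm (g []) _ ⟩
  total n f * g []                            ≡⟨ cong (_* g []) (sym (*-identityˡ (total n f))) ⟩
  1 * total n f * g []
    ≡⟨ cong₂ (λ c t → c * total n f * t) (sym (nCn≡1 n))
         (sym (trans (cong (λ m → total m g) (n∸n≡0 n)) (total-zero g))) ⟩
  (n C n) * total n f * total (n ∸ n) g       ∎
  where
    whole : ∀ w → length w ≡ n → f (take n w) * g (drop n w) ≡ g [] * f w
    whole w len = trans (cong₂ (λ a b → f a * g b) (take-all n w (≤-reflexive len)) (drop-all n w (≤-reflexive len)))
                        (*-comm (f w) (g []))

-- Summing f(first k letters)·g(rest) over S_n: choose the k values of the
-- prefix, then independently its pattern and the pattern of the suffix.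
total-split : ∀ n k (f g : List Step → ℕ) → HeadBlind g → k ≤ n →
  total n (λ w → f (take k w) * g (drop k w)) ≡ (n C k) * total k f * total (n ∸ k) g
total-split n zero f g _ _ = begin
  total n (λ w → f [] * g w) ≡⟨ total-* n (f []) g ⟩
  f [] * total n g           ≡⟨ cong (_* total n g) (sym (trans (*-identityˡ _) (total-zero f))) ⟩
  1 * total 0 f * total n g  ∎
total-split (suc n) (suc k) f g blind (s≤s k≤n) with m≤n⇒m<n∨m≡n k≤n
... | inj₂ refl = total-split-whole (suc n) f g
... | inj₁ k<n = begin
  total (suc n) (λ w → f (take (suc k) w) * g (drop (suc k) w))
    ≡⟨ total-suc n _ ⟩
  total n (onInsertions (λ w → f (take (suc k) w) * g (drop (suc k) w)))
    ≡⟨ total-cong n (λ w len → onInsertions-split k f g blind w (subst (suc k ≤_) (sym len) k<n)) ⟩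
  total n (λ w → onInsertions f (take k w) * g (drop k w) + f (take (suc k) w) * onInsertions g (drop (suc k) w))
    ≡⟨ total-+ n (λ w → onInsertions f (take k w) * g (drop k w))
                 (λ w → f (take (suc k) w) * onInsertions g (drop (suc k) w)) ⟩
  total n (λ w → onInsertions f (take k w) * g (drop k w))
    + total n (λ w → f (take (suc k) w) * onInsertions g (drop (suc k) w))
    ≡⟨ cong₂ _+_ (total-split n k (onInsertions f) g blind k≤n)
                 (total-split n (suc k) f (onInsertions g) (onInsertions-headBlind g blind) k<n) ⟩
  (n C k) * total k (onInsertions f) * total (n ∸ k) g
    + (n C suc k) * total (suc k) f * total (n ∸ suc k) (onInsertions g)
    ≡⟨ cong₂ (λ a b → (n C k) * a * total (n ∸ k) g + (n C suc k) * total (suc k) f * b)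
         (sym (total-suc k f))
         (trans (sym (total-suc (n ∸ suc k) g)) (cong (λ m → total m g) (sym (+-∸-assoc 1 k<n)))) ⟩
  (n C k) * total (suc k) f * total (n ∸ k) g + (n C suc k) * total (suc k) f * total (n ∸ k) g
    ≡⟨ distrib (n C k) (n C suc k) (total (suc k) f) (total (n ∸ k) g) ⟩
  (n C k + n C suc k) * total (suc k) f * total (n ∸ k) g
    ≡⟨ cong (λ c → c * total (suc k) f * total (n ∸ k) g) (nCk+nC[k+1]≡[n+1]C[k+1] n k) ⟩
  (suc n C suc k) * total (suc k) f * total (n ∸ k) g
    ∎
  where
    distrib : ∀ a b x y → a * x * y + b * x * y ≡ (a + b) * x * y
    distrib = solve-∀

peakPair : Step → Step → Bool
peakPair x y = isRise x ∧ isFall y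

peakFree : List Step → Bool
peakFree (x ∷ y ∷ r) = not (peakPair x y) ∧ peakFree (y ∷ r)
peakFree _ = true

peakFree-fall : ∀ u → peakFree (fall ∷ u) ≡ peakFree u
peakFree-fall [] = refl
peakFree-fall (x ∷ u) = refl

-- After a letter c, only inserting the maximum at the very end avoids a new peak.
peakFree-insertMax-after : ∀ c u → onInsertions (λ w → 𝟙 (peakFree (c ∷ w))) u ≡ 𝟙 (peakFree (c ∷ u))
peakFree-insertMax-after rise [] = refl
peakFree-insertMax-after fall [] = refl
peakFree-insertMax-after level [] = refl
peakFree-insertMax-after c (d ∷ u) = begin
  𝟙 (peakFree (c ∷ rise ∷ fall ∷ d ∷ u)) + sumOver (λ w → 𝟙 (peakFree (c ∷ w))) (map (d ∷_) (insertMax u))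
    ≡⟨ cong₂ _+_ (new-peak c) (sumOver-map _ (d ∷_) (insertMax u)) ⟩
  sumOver (λ w → 𝟙 (not (peakPair c d) ∧ peakFree (d ∷ w))) (insertMax u)
    ≡⟨ sumOver-cong (insertMax u) (λ w → 𝟙-∧ (not (peakPair c d)) (peakFree (d ∷ w))) ⟩
  sumOver (λ w → 𝟙 (not (peakPair c d)) * 𝟙 (peakFree (d ∷ w))) (insertMax u)
    ≡⟨ sumOver-* (𝟙 (not (peakPair c d))) _ (insertMax u) ⟩
  𝟙 (not (peakPair c d)) * onInsertions (λ w → 𝟙 (peakFree (d ∷ w))) u
    ≡⟨ cong (𝟙 (not (peakPair c d)) *_) (peakFree-insertMax-after d u) ⟩
  𝟙 (not (peakPair c d)) * 𝟙 (peakFree (d ∷ u))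
    ≡⟨ sym (𝟙-∧ (not (peakPair c d)) (peakFree (d ∷ u))) ⟩
  𝟙 (peakFree (c ∷ d ∷ u))
    ∎
  where
    new-peak : ∀ x → 𝟙 (peakFree (x ∷ rise ∷ fall ∷ d ∷ u)) ≡ 0
    new-peak rise = refl
    new-peak fall = refl
    new-peak level = refl

peakFree-insertMax : ∀ u → onInsertions (𝟙 ∘ peakFree) u ≡ 𝟙 (peakFree u)
peakFree-insertMax [] = refl
peakFree-insertMax (c ∷ u) = trans (sumOver-map _ (c ∷_) (insertMax u)) (peakFree-insertMax-after c u)

tailPeakFree : List Step → ℕ
tailPeakFree v = 𝟙 (peakFree (drop 1 v))

-- The maximum goes either first or last in a valley.
onInsertions-tailPeakFree : ∀ s u → onInsertions tailPeakFree (s ∷ u) ≡ 2 * tailPeakFree (s ∷ u)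
onInsertions-tailPeakFree s u = begin
  onInsertions tailPeakFree (s ∷ u)                       ≡⟨ onInsertions-cons tailPeakFree s u ⟩
  𝟙 (peakFree (fall ∷ u)) + onInsertions (𝟙 ∘ peakFree) u ≡⟨ cong₂ _+_ (cong 𝟙 (peakFree-fall u)) (peakFree-insertMax u) ⟩
  𝟙 (peakFree u) + 𝟙 (peakFree u)                         ≡⟨ cong (𝟙 (peakFree u) +_) (sym (+-identityʳ _)) ⟩
  2 * tailPeakFree (s ∷ u)                                ∎

total-valleys : ∀ r → total (suc r) tailPeakFree ≡ 2 ^ r
total-valleys zero = refl
total-valleys (suc r) = begin
  total (2 + r) tailPeakFree               ≡⟨ total-suc (suc r) tailPeakFree ⟩
  total (suc r) (onInsertions tailPeakFree) ≡⟨ total-cong (suc r) doubled ⟩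
  total (suc r) (λ w → 2 * tailPeakFree w)  ≡⟨ total-* (suc r) 2 tailPeakFree ⟩
  2 * total (suc r) tailPeakFree            ≡⟨ cong (2 *_) (total-valleys r) ⟩
  2 * 2 ^ r                                 ∎
  where
    doubled : ∀ w → length w ≡ suc r → onInsertions tailPeakFree w ≡ 2 * tailPeakFree w
    doubled (s ∷ u) _ = onInsertions-tailPeakFree s u

peaksW : ℕ → List Step → List ℕ
peaksW i (x ∷ y ∷ r) = (if peakPair x y then [ i ] else []) ++ peaksW (suc i) (y ∷ r)
peaksW i _ = []

peaksFrom-updown : ∀ i a π → peaksFrom i (a ∷ π) ≡ peaksW i (updown a π)
peaksFrom-updown i a [] = refl
peaksFrom-updown i a (b ∷ []) = refl
peaksFrom-updown i a (b ∷ c ∷ rest) =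
  cong₂ (λ isPeak later → (if isPeak then [ i ] else []) ++ later)
    (cong₂ _∧_ (sym (isRise-step a b)) (sym (isFall-step b c)))
    (peaksFrom-updown (suc i) b (c ∷ rest))

pairAt : List Step → ℕ → Bool
pairAt [] _ = false
pairAt (x ∷ r) (suc i) = pairAt r i
pairAt (x ∷ []) zero = false
pairAt (x ∷ y ∷ _) zero = peakPair x y

peakAt : List Step → ℕ → Bool
peakAt w zero = false
peakAt w (suc i) = pairAt w i

PeaksAre : List Step → List ℕ → Set
PeaksAre w X = ∀ j → peakAt w j ≡ elemᵇ j X

elemᵇ-when : ∀ c j i → elemᵇ j (if c then [ i ] else []) ≡ (c ∧ (j ≡ᵇ i))
elemᵇ-when true j i = ∨-identityʳ (j ≡ᵇ i)
elemᵇ-when false j i = refl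

elemᵇ-peaksW : ∀ j i x y r →
  elemᵇ j (peaksW i (x ∷ y ∷ r)) ≡ ((peakPair x y ∧ (j ≡ᵇ i)) ∨ elemᵇ j (peaksW (suc i) (y ∷ r)))
elemᵇ-peaksW j i x y r =
  trans (elemᵇ-++ j (if peakPair x y then [ i ] else []) _) (cong (_∨ _) (elemᵇ-when (peakPair x y) j i))

peaksW-below : ∀ w {i j} → j < i → elemᵇ j (peaksW i w) ≡ false
peaksW-below [] _ = refl
peaksW-below (x ∷ []) _ = refl
peaksW-below (x ∷ y ∷ r) {i} {j} j<i = trans (elemᵇ-peaksW j i x y r)
  (cong₂ _∨_ (trans (cong (peakPair x y ∧_) (≡ᵇ-false (<⇒≢ j<i))) (∧-zeroʳ _))
             (peaksW-below (y ∷ r) (m<n⇒m<1+n j<i)))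

peaksW-at : ∀ w i d → elemᵇ (i + d) (peaksW i w) ≡ pairAt w d
peaksW-at [] i d = refl
peaksW-at (x ∷ []) i zero = refl
peaksW-at (x ∷ []) i (suc d) = refl
peaksW-at (x ∷ y ∷ r) i zero rewrite +-identityʳ i = trans (elemᵇ-peaksW i i x y r)
  (trans (cong₂ _∨_ (trans (cong (peakPair x y ∧_) (≡ᵇ-refl i)) (∧-identityʳ _)) (peaksW-below (y ∷ r) (n<1+n i)))
         (∨-identityʳ _))
peaksW-at (x ∷ y ∷ r) i (suc d) = trans (elemᵇ-peaksW (i + suc d) i x y r)
  (cong₂ _∨_ (trans (cong (peakPair x y ∧_) (≡ᵇ-false (m+1+n≢m i))) (∧-zeroʳ _))
             (trans (cong (λ j → elemᵇ j (peaksW (suc i) (y ∷ r))) (+-suc i d)) (peaksW-at (y ∷ r) (suc i) d)))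

peakAt-elemᵇ : ∀ w j → elemᵇ j (peaksW 1 w) ≡ peakAt w j
peakAt-elemᵇ w zero = peaksW-below w z<s
peakAt-elemᵇ w (suc d) = peaksW-at w 1 d

peaksIs : List ℕ → List Step → Bool
peaksIs X w = sameSetᵇ (peaksW 1 w) X

peaksIs-true : ∀ X w → peaksIs X w ≡ true ⇔ PeaksAre w X
peaksIs-true X w = mk⇔
  (λ h j → trans (sym (peakAt-elemᵇ w j)) (Equivalence.to (sameSetᵇ-true (peaksW 1 w) X) h j))
  (λ P → Equivalence.from (sameSetᵇ-true (peaksW 1 w) X) (λ j → trans (peakAt-elemᵇ w j) (P j)))

#Phat-total : ∀ X n → #Phat X n ≡ total n (𝟙 ∘ peaksIs X)
#Phat-total X n = trans (length-filterᵇ _ (perms n))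
  (sumOver-cong (perms n) (λ π → cong (λ P → 𝟙 (sameSetᵇ P X)) (peaksFrom-updown 1 0 π)))
  where
    length-filterᵇ : ∀ (p : List ℕ → Bool) xs → length (filterᵇ p xs) ≡ sumOver (𝟙 ∘ p) xs
    length-filterᵇ p [] = refl
    length-filterᵇ p (x ∷ xs) with p x
    ... | true = cong suc (length-filterᵇ p xs)
    ... | false = length-filterᵇ p xs

pairAt-length : ∀ w i → pairAt w i ≡ true → suc (suc i) ≤ length w
pairAt-length (x ∷ y ∷ r) zero _ = s≤s (s≤s z≤n)
pairAt-length (x ∷ r) (suc i) e = s≤s (pairAt-length r i e)

pairAt-drop : ∀ m w i → pairAt (drop m w) i ≡ pairAt w (m + i)
pairAt-drop zero w i = refl
pairAt-drop (suc m) [] i = refl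
pairAt-drop (suc m) (x ∷ w) i = pairAt-drop m w i

pairAt-take : ∀ k i w → suc (suc i) ≤ k → pairAt (take k w) i ≡ pairAt w i
pairAt-take (suc k) zero [] _ = refl
pairAt-take (suc zero) zero (x ∷ w) (s≤s ())
pairAt-take (suc (suc k)) zero (x ∷ []) _ = refl
pairAt-take (suc (suc k)) zero (x ∷ y ∷ r) _ = refl
pairAt-take (suc k) (suc i) [] _ = refl
pairAt-take (suc k) (suc i) (x ∷ r) (s≤s i<k) = pairAt-take k i r i<k

pairAt-take-beyond : ∀ k i w → k ≤ suc i → pairAt (take k w) i ≡ false
pairAt-take-beyond zero i w _ = refl
pairAt-take-beyond (suc zero) zero [] _ = refl
pairAt-take-beyond (suc zero) zero (x ∷ w) _ = refl
pairAt-take-beyond (suc (suc k)) zero w (s≤s ())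
pairAt-take-beyond (suc k) (suc i) [] _ = refl
pairAt-take-beyond (suc k) (suc i) (x ∷ w) (s≤s k≤i) = pairAt-take-beyond k i w k≤i

peakAt-take-below : ∀ w {k j} → j < k → peakAt (take k w) j ≡ peakAt w j
peakAt-take-below w {j = zero} _ = refl
peakAt-take-below w {k} {suc i} i<k = pairAt-take k i w i<k

peakAt-take-above : ∀ w {k j} → k ≤ j → peakAt (take k w) j ≡ false
peakAt-take-above w {j = zero} _ = refl
peakAt-take-above w {k} {suc i} k≤j = pairAt-take-beyond k i w k≤j

peakFree-true : ∀ u → peakFree u ≡ true ⇔ (∀ i → pairAt u i ≡ false)
peakFree-true u = mk⇔ (to u) (from u)
  where
    to : ∀ u → peakFree u ≡ true → ∀ i → pairAt u i ≡ false
    to [] _ i = refl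
    to (x ∷ []) _ zero = refl
    to (x ∷ []) _ (suc i) = refl
    to (x ∷ y ∷ r) e zero = not-injective (proj₁ (Equivalence.to ∧-true e))
    to (x ∷ y ∷ r) e (suc i) = to (y ∷ r) (proj₂ (Equivalence.to (∧-true {not (peakPair x y)}) e)) i
    from : ∀ u → (∀ i → pairAt u i ≡ false) → peakFree u ≡ true
    from [] _ = refl
    from (x ∷ []) _ = refl
    from (x ∷ y ∷ r) h = Equivalence.from ∧-true (cong not (h 0) , from (y ∷ r) (h ∘ suc))

-- The middle letter cannot be both the fall of one peak and the rise of the next:
-- peaks are never adjacent.
no-adjacent-peaks : ∀ w k → (peakAt w k ∧ peakAt w (suc k)) ≡ false
no-adjacent-peaks w zero = refl
no-adjacent-peaks w (suc i) = no-adjacent-pairs w i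
  where
    rise-fall-rise : ∀ x y z → (peakPair x y ∧ peakPair y z) ≡ false
    rise-fall-rise rise rise z = refl
    rise-fall-rise rise fall z = refl
    rise-fall-rise rise level z = refl
    rise-fall-rise fall y z = refl
    rise-fall-rise level y z = refl
    no-adjacent-pairs : ∀ w i → (pairAt w i ∧ pairAt w (suc i)) ≡ false
    no-adjacent-pairs [] i = refl
    no-adjacent-pairs (x ∷ []) zero = refl
    no-adjacent-pairs (x ∷ []) (suc i) = refl
    no-adjacent-pairs (x ∷ y ∷ []) zero = ∧-zeroʳ (peakPair x y)
    no-adjacent-pairs (x ∷ y ∷ z ∷ r) zero = rise-fall-rise x y z
    no-adjacent-pairs (x ∷ r) (suc i) = no-adjacent-pairs r i

record ExtendsAt (k : ℕ) (S₁ X : List ℕ) (α β : Bool) : Set where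
  field
    below : ∀ j → j < k → elemᵇ j X ≡ elemᵇ j S₁
    atK : elemᵇ k X ≡ α
    atNext : elemᵇ (suc k) X ≡ β
    above : ∀ j → suc k < j → elemᵇ j X ≡ false

data Position (k : ℕ) : ℕ → Set where
  before : ∀ {j} → j < k → Position k j
  at : Position k k
  next : Position k (suc k)
  after : ∀ i → Position k (suc (suc (k + i)))

position : ∀ k j → Position k j
position zero zero = at
position zero (suc zero) = next
position zero (suc (suc i)) = after i
position (suc k) zero = before z<s
position (suc k) (suc j) with position k j
... | before j<k = before (s≤s j<k)
... | at = at
... | next = next
... | after i = after i

beyond : ∀ k i → suc k < suc (suc (k + i))
beyond k i = s≤s (s≤s (m≤m+n k i))

LocalPeaks : List Step → ℕ → List ℕ → Bool → Bool → Set
LocalPeaks w k S₁ α β =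
  peakAt w k ≡ α × peakAt w (suc k) ≡ β × PeaksAre (take k w) S₁ × (∀ i → pairAt (drop (suc k) w) i ≡ false)

localTest : List Step → ℕ → List ℕ → Bool → Bool → Bool
localTest w k S₁ α β = (peakAt w k == α) ∧ (peakAt w (suc k) == β) ∧ peaksIs S₁ (take k w) ∧ peakFree (drop (suc k) w)

localTest-true : ∀ w k S₁ α β → localTest w k S₁ α β ≡ true ⇔ LocalPeaks w k S₁ α β
localTest-true w k S₁ α β =
  ⇔.trans ∧-true (==-true ×-⇔ ⇔.trans ∧-true (==-true ×-⇔ ⇔.trans ∧-true
    (peaksIs-true S₁ (take k w) ×-⇔ peakFree-true (drop (suc k) w))))

module _ {k : ℕ} {S₁ X : List ℕ} {α β : Bool} (S₁<k : All (_< k) S₁) (ext : ExtendsAt k S₁ X α β) where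
  open ExtendsAt ext

  peaks-local : ∀ w → PeaksAre w X ⇔ LocalPeaks w k S₁ α β
  peaks-local w = mk⇔ to from
    where
      to : PeaksAre w X → LocalPeaks w k S₁ α β
      to P = trans (P k) atK , trans (P (suc k)) atNext , prefix , suffix
        where
          prefix : PeaksAre (take k w) S₁
          prefix j with j <? k
          ... | yes j<k = trans (peakAt-take-below w j<k) (trans (P j) (below j j<k))
          ... | no j≮k = trans (peakAt-take-above w (≮⇒≥ j≮k)) (sym (elemᵇ-above S₁<k (≮⇒≥ j≮k)))
          suffix : ∀ i → pairAt (drop (suc k) w) i ≡ false
          suffix i = trans (pairAt-drop (suc k) w i) (trans (P (suc (suc (k + i)))) (above _ (beyond k i)))
      from : LocalPeaks w k S₁ α β → PeaksAre w X
      from (peakK , peakNext , prefix , suffix) j = at-position (position k j)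
        where
          at-position : ∀ {j} → Position k j → peakAt w j ≡ elemᵇ j X
          at-position {j} (before j<k) = trans (sym (peakAt-take-below w j<k)) (trans (prefix j) (sym (below j j<k)))
          at-position at = trans peakK (sym atK)
          at-position next = trans peakNext (sym atNext)
          at-position (after i) = trans (sym (pairAt-drop (suc k) w i)) (trans (suffix i) (sym (above _ (beyond k i))))

  peaksIs-local : ∀ w → peaksIs X w ≡ localTest w k S₁ α β
  peaksIs-local w = bool-⇔ (⇔.trans (peaksIs-true X w) (⇔.trans (peaks-local w) (⇔.sym (localTest-true w k S₁ α β))))

module _ {k : ℕ} {S₁ : List ℕ} (S₁<k : All (_< k) S₁) where
  private
    absent : ∀ {j} → k ≤ j → elemᵇ j S₁ ≡ false
    absent = elemᵇ-above S₁<k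
    far : ∀ {j} → suc k < j → k ≤ j
    far sk<j = ≤-trans (n≤1+n _) (<⇒≤ sk<j)

  extends-S : ExtendsAt k S₁ (S₁ ++ [ suc k ]) false true
  extends-S = record
    { below = λ j j<k → trans (elemᵇ-snoc j S₁ (suc k))
        (trans (cong (elemᵇ j S₁ ∨_) (≡ᵇ-false (<⇒≢ (m<n⇒m<1+n j<k)))) (∨-identityʳ _))
    ; atK = trans (elemᵇ-snoc k S₁ (suc k)) (cong₂ _∨_ (absent ≤-refl) (≡ᵇ-false (<⇒≢ (n<1+n k))))
    ; atNext = trans (elemᵇ-snoc (suc k) S₁ (suc k)) (cong₂ _∨_ (absent (n≤1+n k)) (≡ᵇ-refl k))
    ; above = λ j sk<j → trans (elemᵇ-snoc j S₁ (suc k)) (cong₂ _∨_ (absent (far sk<j)) (≡ᵇ-false (>⇒≢ sk<j)))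
    }

  extends-S₁ : ExtendsAt k S₁ S₁ false false
  extends-S₁ = record
    { below = λ _ _ → refl
    ; atK = absent ≤-refl
    ; atNext = absent (n≤1+n k)
    ; above = λ _ sk<j → absent (far sk<j)
    }

  extends-S₂ : ExtendsAt k S₁ (k ∷ S₁) true false
  extends-S₂ = record
    { below = λ j j<k → cong (_∨ elemᵇ j S₁) (≡ᵇ-false (<⇒≢ j<k))
    ; atK = cong (_∨ elemᵇ k S₁) (≡ᵇ-refl k)
    ; atNext = cong₂ _∨_ (≡ᵇ-false (>⇒≢ (n<1+n k))) (absent (n≤1+n k))
    ; above = λ j sk<j → cong₂ _∨_ (≡ᵇ-false (>⇒≢ (<-trans (n<1+n k) sk<j))) (absent (far sk<j))
    }

-- Of the three patterns (no, yes), (no, no), (yes, no) at k, k+1 exactly one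
-- occurs, since (yes, yes) is excluded.
three-patterns : ∀ a b p c → (a ∧ b) ≡ false →
  𝟙 ((a == false) ∧ (b == true) ∧ p ∧ c) + 𝟙 ((a == false) ∧ (b == false) ∧ p ∧ c)
    + 𝟙 ((a == true) ∧ (b == false) ∧ p ∧ c) ≡ 𝟙 p * 𝟙 c
three-patterns false true p c _ = trans (+-identityʳ _) (trans (+-identityʳ _) (𝟙-∧ p c))
three-patterns false false p c _ = trans (+-identityʳ _) (𝟙-∧ p c)
three-patterns true false p c _ = 𝟙-∧ p c

peaks-three-ways : ∀ {k} {S₁ : List ℕ} → All (_< k) S₁ → ∀ w →
  𝟙 (peaksIs (S₁ ++ [ suc k ]) w) + 𝟙 (peaksIs S₁ w) + 𝟙 (peaksIs (k ∷ S₁) w)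
    ≡ 𝟙 (peaksIs S₁ (take k w)) * tailPeakFree (drop k w)
peaks-three-ways {k} {S₁} S₁<k w = begin
  𝟙 (peaksIs (S₁ ++ [ suc k ]) w) + 𝟙 (peaksIs S₁ w) + 𝟙 (peaksIs (k ∷ S₁) w)
    ≡⟨ cong₂ _+_ (cong₂ _+_ (cong 𝟙 (peaksIs-local S₁<k (extends-S S₁<k) w))
                            (cong 𝟙 (peaksIs-local S₁<k (extends-S₁ S₁<k) w)))
                 (cong 𝟙 (peaksIs-local S₁<k (extends-S₂ S₁<k) w)) ⟩
  𝟙 (localTest w k S₁ false true) + 𝟙 (localTest w k S₁ false false) + 𝟙 (localTest w k S₁ true false)
    ≡⟨ three-patterns (peakAt w k) (peakAt w (suc k)) (peaksIs S₁ (take k w)) (peakFree (drop (suc k) w))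
                      (no-adjacent-peaks w k) ⟩
  𝟙 (peaksIs S₁ (take k w)) * 𝟙 (peakFree (drop (suc k) w))
    ≡⟨ cong (λ u → 𝟙 (peaksIs S₁ (take k w)) * 𝟙 (peakFree u)) (sym drop-suc) ⟩
  𝟙 (peaksIs S₁ (take k w)) * tailPeakFree (drop k w)
    ∎
  where
    drop-suc : drop 1 (drop k w) ≡ drop (suc k) w
    drop-suc = trans (drop-drop k 1 w) (cong (λ m → drop m w) (+-comm k 1))

count-identity : ∀ (S₁ : List ℕ) k n → All (_< k) S₁ → k < n →
  #Phat (S₁ ++ [ suc k ]) n + #Phat S₁ n + #Phat (k ∷ S₁) n ≡ (n C k) * #Phat S₁ k * 2 ^ (n ∸ suc k)
count-identity S₁ k n S₁<k k<n = begin
  #Phat S n + #Phat S₁ n + #Phat S₂ n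
    ≡⟨ cong₂ _+_ (cong₂ _+_ (#Phat-total S n) (#Phat-total S₁ n)) (#Phat-total S₂ n) ⟩
  total n (𝟙 ∘ peaksIs S) + total n (𝟙 ∘ peaksIs S₁) + total n (𝟙 ∘ peaksIs S₂)
    ≡⟨ sym (trans (total-+ n (λ w → 𝟙 (peaksIs S w) + 𝟙 (peaksIs S₁ w)) (𝟙 ∘ peaksIs S₂))
                  (cong (_+ total n (𝟙 ∘ peaksIs S₂)) (total-+ n (𝟙 ∘ peaksIs S) (𝟙 ∘ peaksIs S₁)))) ⟩
  total n (λ w → 𝟙 (peaksIs S w) + 𝟙 (peaksIs S₁ w) + 𝟙 (peaksIs S₂ w))
    ≡⟨ total-cong n (λ w _ → peaks-three-ways S₁<k w) ⟩
  total n (λ w → 𝟙 (peaksIs S₁ (take k w)) * tailPeakFree (drop k w))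
    ≡⟨ total-split n k (𝟙 ∘ peaksIs S₁) tailPeakFree (λ _ _ _ → refl) (<⇒≤ k<n) ⟩
  (n C k) * total k (𝟙 ∘ peaksIs S₁) * total (n ∸ k) tailPeakFree
    ≡⟨ cong₂ (λ a b → (n C k) * a * b) (sym (#Phat-total S₁ k))
             (trans (cong (λ m → total m tailPeakFree) (+-∸-assoc 1 k<n)) (total-valleys (n ∸ suc k))) ⟩
  (n C k) * #Phat S₁ k * 2 ^ (n ∸ suc k)
    ∎
  where
    S S₂ : List ℕ
    S = S₁ ++ [ suc k ]
    S₂ = k ∷ S₁

below-last : ∀ (S₁ : List ℕ) {m} → Linked _<_ (S₁ ++ [ m ]) → All (_< m) S₁
below-last [] _ = []
below-last (x ∷ []) (x<m ∷ _) = x<m ∷ []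
below-last (x ∷ y ∷ S₁) (x<y ∷ increasing) with below-last (y ∷ S₁) increasing
... | y<m ∷ rest = <-trans x<y y<m ∷ y<m ∷ rest

-- In a word with peak set S₁ ∪ {iₛ}, iₛ > S₁: iₛ = k+1 is followed by a letter,
-- and S₁ lies below k because peaks are not adjacent.
last-peak : ∀ w (S₁ : List ℕ) iₛ → All (_< iₛ) S₁ → PeaksAre w (S₁ ++ [ iₛ ]) →
  ∃[ k ] (iₛ ≡ suc k × suc (suc k) ≤ length w × All (_< k) S₁)
last-peak w S₁ zero _ peaks = ⊥-elim (false≢true (trans (peaks 0) (elemᵇ-last S₁ 0)))
last-peak w S₁ (suc k) S₁<iₛ peaks =
  k , refl , pairAt-length w k last , All.zipWith below-k (S₁<iₛ , elemᵇ-self S₁)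
  where
    last : peakAt w (suc k) ≡ true
    last = trans (peaks (suc k)) (elemᵇ-last S₁ (suc k))
    below-k : ∀ {x} → x < suc k × elemᵇ x S₁ ≡ true → x < k
    below-k {x} (x<iₛ , x∈S₁) = ≤∧≢⇒< (s≤s⁻¹ x<iₛ) λ { refl →
      false≢true (trans (sym (no-adjacent-peaks w x))
        (cong₂ _∧_ (trans (peaks x) (trans (elemᵇ-++ x S₁ _) (cong (_∨ _) x∈S₁))) last)) }

filterᵇ-witness : ∀ {P : A → Set} (p : A → Bool) xs → All P xs → length (filterᵇ p xs) ≢ 0 →
  ∃[ x ] (P x × p x ≡ true)
filterᵇ-witness p [] [] nonempty = ⊥-elim (nonempty refl)
filterᵇ-witness p (x ∷ xs) (px ∷ pxs) nonempty with p x in e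
... | true = x , px , e
... | false = filterᵇ-witness p xs pxs nonempty

-- Admissibility at n provides a witness permutation, which locates iₛ.
last-peak-position : ∀ (S₁ : List ℕ) iₛ n → Linked _<_ (S₁ ++ [ iₛ ]) → #Phat (S₁ ++ [ iₛ ]) n ≢ 0 →
  ∃[ k ] (iₛ ≡ suc k × k < n × All (_< k) S₁)
last-peak-position S₁ iₛ n increasing admissible
  with filterᵇ-witness (λ π → sameSetᵇ (peakSet π) (S₁ ++ [ iₛ ])) (perms n) (perms-sized n) admissible
... | π , (len , _) , hasS
  with last-peak (updown 0 π) S₁ iₛ (below-last S₁ increasing)
         (Equivalence.to (peaksIs-true (S₁ ++ [ iₛ ]) (updown 0 π))
           (subst (λ P → sameSetᵇ P (S₁ ++ [ iₛ ]) ≡ true) (peaksFrom-updown 1 0 π) hasS))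
... | k , iₛ≡ , room , S₁<k = k , iₛ≡ , <⇒≤ (subst (suc (suc k) ≤_) (trans (updown-length 0 π) len) room) , S₁<k

theorem4p1 : (S₁ : List ℕ) (iₛ n : ℕ) →
    Linked _<_ (S₁ ++ [ iₛ ]) →
    #Phat (S₁ ++ [ iₛ ]) n ≢ 0 →
    #Phat (S₁ ++ [ iₛ ]) n + #Phat S₁ n + #Phat ((iₛ ∸ 1) ∷ S₁) n
      ≡ (n C (iₛ ∸ 1)) * #Phat S₁ (iₛ ∸ 1) * 2 ^ (n ∸ iₛ)
theorem4p1 S₁ iₛ n increasing admissible with last-peak-position S₁ iₛ n increasing admissible
... | k , refl , k<n , S₁<k = count-identity S₁ k n S₁<k k<n
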